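{- Let $\lambda$ be a partition, $\phi$ a flag compatible with $\lambda$, and $\rho\subseteq\nu\subseteq\lambda$ partitions. Define $\xi(\nu)=(\xi(\nu)_1,\dots,\xi(\nu)_{\nu_1})$ by $\xi(\nu)_i=-\phi^-_{\nu'_i}$. If $\nu/\rho$ has a cell in some row $i$ with $\phi_i\ge0$, then $\nu'/\rho'$ has a cell in some row $j$ with $\xi(\nu)_j=0$.
   Context: Partitions are Young diagrams in matrix coordinates; $\nu/\rho$ is the set of cells of $\nu$ not in $\rho$, and $\nu'$ is the conjugate partition. A flag for $\lambda$ is a weakly increasing integer sequence $(\phi_1\le\dots\le\phi_{\ell(\lambda)})$; it is compatible with $\lambda$ if $\phi_{i+1}-\phi_i\le\lambda_i-\lambda_{i+1}+1$ for $1\le i<\ell(\lambda)$. $\phi^-_i=\min(\phi_i,0)$. -}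

module Defs where

open import Data.Nat as ℕ using (ℕ; zero; suc; _≤_; _<_; _≥_; _≤?_)
open import Data.Integer as ℤ using (ℤ; _⊓_; -_)
open import Data.List using (List; []; _∷_; length; map; filter; upTo)
open import Data.List.Relation.Unary.All using (All)
open import Data.List.Relation.Unary.Linked using (Linked)
open import Relation.Binary.PropositionalEquality using (_≡_)
open import Function using (flip)

-- 1-based indexing with a default value outside the range:
-- at d xs i = xs_i  (i = 1 .. length xs),  d otherwise (in particular at index 0).
at : {A : Set} → A → List A → ℕ → A
at d []       _             = d
at d (x ∷ xs) zero          = d
at d (x ∷ xs) (suc zero)    = x
at d (x ∷ xs) (suc (suc i)) = at d xs (suc i)

_⟨_⟩ : List ℕ → ℕ → ℕ
ν ⟨ i ⟩ = at 0 ν i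

IsPartition : List ℕ → Set
IsPartition ν = Linked (flip _≤_) ν × All (0 <_) ν
  where open import Data.Product using (_×_)

_⊆ₚ_ : List ℕ → List ℕ → Set
ρ ⊆ₚ ν = ∀ i → ρ ⟨ i ⟩ ≤ ν ⟨ i ⟩

-- conjugate partition: ν'_j = #{ i : ν_i ≥ j }, for j = 1 .. ν_1
conj : List ℕ → List ℕ
conj ν = map (λ j → length (filter (λ x → suc j ≤? x) ν)) (upTo (ν ⟨ 1 ⟩))

_⟪_⟫ : List ℤ → ℕ → ℤ
φ ⟪ i ⟫ = at (ℤ.+ 0) φ i

IsFlag : List ℕ → List ℤ → Set
IsFlag λp φ = Linked ℤ._≤_ φ × length φ ≡ length λp
  where open import Data.Product using (_×_)

Compatible : List ℕ → List ℤ → Set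
Compatible λp φ = ∀ i → 1 ≤ i → i < length λp →
  (φ ⟪ suc i ⟫ ℤ.- φ ⟪ i ⟫) ℤ.≤ ((ℤ.+ (λp ⟨ i ⟩) ℤ.- ℤ.+ (λp ⟨ suc i ⟩)) ℤ.+ ℤ.+ 1)

φ⁻ : List ℤ → ℕ → ℤ
φ⁻ φ i = φ ⟪ i ⟫ ⊓ ℤ.+ 0

ξ : List ℤ → List ℕ → List ℤ
ξ φ ν = map (λ c → - φ⁻ φ c) (conj ν)

ξat : List ℤ → List ℕ → ℕ → ℤ
ξat φ ν j = at (ℤ.+ 0) (ξ φ ν) j

module Submission where

open import Defs
open import Data.Nat using (ℕ; _≤_; _<_)
open import Data.Integer using (ℤ; +_)
open import Data.List using (List)
open import Data.Product using (_×_; ∃-syntax)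
open import Relation.Binary.PropositionalEquality using (_≡_)

open import Data.Nat using (zero; suc; z≤n; s≤s; _≤?_; _<?_; _≤′_; ≤′-refl; ≤′-step)
open import Data.Nat.Properties
  using (≤-trans; ≤-reflexive; ≤-<-trans; <-≤-trans; n≤1+n; n≮0; n<1⇒n≡0; <⇒≱; ≰⇒>; ≮⇒≥; ≤⇒≤′; ≤′⇒≤)
import Data.Integer as ℤ
open import Data.Integer.Properties using (i≥j⇒i⊓j≡j) renaming (≤-trans to ℤ≤-trans)
open import Data.List using ([]; _∷_; length; filter; map; applyUpTo)
open import Data.List.Properties using (filter-accept; filter-reject; map-upTo)
open import Data.List.Relation.Unary.Linked using (Linked; _∷_; tail)
open import Data.Product using (_,_)
open import Data.Empty using (⊥-elim)
open import Function using (flip)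
open import Relation.Nullary using (Dec; yes; no)
open import Relation.Binary.PropositionalEquality using (refl; sym; trans; cong; subst; module ≡-Reasoning)

-- Take j = ν_i.  Then ρ_i < j ≤ ν_i gives ρ'_j < i ≤ ν'_j, and since φ is weakly
-- increasing, φ_{ν'_j} ≥ φ_i ≥ 0, i.e. ξ(ν)_j = 0.

at-zero : ∀ {A : Set} (d : A) xs → at d xs 0 ≡ d
at-zero d []       = refl
at-zero d (_ ∷ _)  = refl

at-map : ∀ {A B : Set} (f : A → B) {d e} → f d ≡ e → ∀ xs k → at e (map f xs) k ≡ f (at d xs k)
at-map f fd≡e []       k             = sym fd≡e
at-map f fd≡e (x ∷ xs) zero          = sym fd≡e
at-map f fd≡e (x ∷ xs) (suc zero)    = refl
at-map f fd≡e (x ∷ xs) (suc (suc k)) = at-map f fd≡e xs (suc k)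

at-applyUpTo : ∀ {A : Set} (d : A) f n k → k < n → at d (applyUpTo f n) (suc k) ≡ f k
at-applyUpTo d f (suc n)       zero    _         = refl
at-applyUpTo d f (suc (suc n)) (suc k) (s≤s k<n) = at-applyUpTo d (λ m → f (suc m)) (suc n) k k<n

at-applyUpTo-≥ : ∀ {A : Set} (d : A) f n k → n ≤ k → at d (applyUpTo f n) (suc k) ≡ d
at-applyUpTo-≥ d f zero          k       _         = refl
at-applyUpTo-≥ d f (suc zero)    (suc k) _         = refl
at-applyUpTo-≥ d f (suc (suc n)) (suc k) (s≤s n≤k) = at-applyUpTo-≥ d (λ m → f (suc m)) (suc n) k n≤k

Decreasing : List ℕ → Set
Decreasing = Linked (flip _≤_)

atLeast : ℕ → List ℕ → ℕ
atLeast j xs = length (filter (j ≤?_) xs)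

module _ {j x : ℕ} {xs : List ℕ} where

  atLeast-accept : j ≤ x → atLeast j (x ∷ xs) ≡ suc (atLeast j xs)
  atLeast-accept j≤x = cong length (filter-accept (j ≤?_) j≤x)

  atLeast-reject : x < j → atLeast j (x ∷ xs) ≡ atLeast j xs
  atLeast-reject x<j = cong length (filter-reject (j ≤?_) (<⇒≱ x<j))

  atLeast-∷-≤ : atLeast j (x ∷ xs) ≤ suc (atLeast j xs)
  atLeast-∷-≤ with j ≤? x
  ... | yes j≤x = ≤-reflexive (atLeast-accept j≤x)
  ... | no  j≰x = subst (_≤ suc (atLeast j xs)) (sym (atLeast-reject (≰⇒> j≰x))) (n≤1+n _)

⟨⟩-≤-head : ∀ {x xs} → Decreasing (x ∷ xs) → ∀ m → xs ⟨ m ⟩ ≤ x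
⟨⟩-≤-head {xs = []}    _         _             = z≤n
⟨⟩-≤-head {xs = _ ∷ _} _         zero          = z≤n
⟨⟩-≤-head {xs = _ ∷ _} (y≤x ∷ _) (suc zero)    = y≤x
⟨⟩-≤-head {xs = _ ∷ _} (y≤x ∷ l) (suc (suc m)) = ≤-trans (⟨⟩-≤-head l (suc m)) y≤x

≤-atLeast : ∀ {k xs} → Decreasing xs → ∀ i → 1 ≤ i → suc k ≤ xs ⟨ i ⟩ → i ≤ atLeast (suc k) xs
≤-atLeast {xs = []}     _ (suc i) _ ()
≤-atLeast {xs = x ∷ xs} l (suc zero) _ k<x =
  subst (1 ≤_) (sym (atLeast-accept k<x)) (s≤s z≤n)
≤-atLeast {xs = x ∷ xs} l (suc (suc i)) _ k<xsᵢ =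
  subst (suc (suc i) ≤_) (sym (atLeast-accept (≤-trans k<xsᵢ (⟨⟩-≤-head l (suc i)))))
    (s≤s (≤-atLeast (tail l) (suc i) (s≤s z≤n) k<xsᵢ))

atLeast-< : ∀ {j xs} → Decreasing xs → ∀ i → 1 ≤ i → xs ⟨ i ⟩ < j → atLeast j xs < i
atLeast-< {xs = []}     _ i 1≤i _ = 1≤i
atLeast-< {xs = x ∷ xs} l (suc zero) _ x<j =
  subst (_< 1) (sym (atLeast-reject x<j))
    (atLeast-< (tail l) 1 (s≤s z≤n) (≤-<-trans (⟨⟩-≤-head l 1) x<j))
atLeast-< {xs = x ∷ xs} l (suc (suc i)) _ xsᵢ<j =
  ≤-<-trans (atLeast-∷-≤ {x = x} {xs}) (s≤s (atLeast-< (tail l) (suc i) (s≤s z≤n) xsᵢ<j))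

conj-⟨⟩ : ∀ {ν} → Decreasing ν → ∀ k → conj ν ⟨ suc k ⟩ ≡ atLeast (suc k) ν
conj-⟨⟩ {ν} ν↓ k = trans (cong (_⟨ suc k ⟩) (map-upTo column (ν ⟨ 1 ⟩))) (at-columns (k <? ν ⟨ 1 ⟩))
  where
  column : ℕ → ℕ
  column m = atLeast (suc m) ν
  at-columns : Dec (k < ν ⟨ 1 ⟩) → applyUpTo column (ν ⟨ 1 ⟩) ⟨ suc k ⟩ ≡ atLeast (suc k) ν
  at-columns (yes k<ν₁) = at-applyUpTo 0 column (ν ⟨ 1 ⟩) k k<ν₁
  at-columns (no  k≮ν₁) = trans (at-applyUpTo-≥ 0 column (ν ⟨ 1 ⟩) k (≮⇒≥ k≮ν₁))
    (sym (n<1⇒n≡0 (atLeast-< ν↓ 1 (s≤s z≤n) (s≤s (≮⇒≥ k≮ν₁)))))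

≤-conj : ∀ {ν k} → Decreasing ν → ∀ i → 1 ≤ i → suc k ≤ ν ⟨ i ⟩ → i ≤ conj ν ⟨ suc k ⟩
≤-conj {k = k} ν↓ i 1≤i k<νᵢ = subst (i ≤_) (sym (conj-⟨⟩ ν↓ k)) (≤-atLeast ν↓ i 1≤i k<νᵢ)

conj-< : ∀ {ρ k} → Decreasing ρ → ∀ i → 1 ≤ i → ρ ⟨ i ⟩ < suc k → conj ρ ⟨ suc k ⟩ < i
conj-< {k = k} ρ↓ i 1≤i ρᵢ≤k = subst (_< i) (sym (conj-⟨⟩ ρ↓ k)) (atLeast-< ρ↓ i 1≤i ρᵢ≤k)

Increasing : List ℤ → Set
Increasing = Linked ℤ._≤_

-- Past the end of φ, φ ⟪ i ⟫ defaults to 0, so non-negativity still propagates.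
⟪⟫-nonneg-suc : ∀ {φ} → Increasing φ → ∀ i → 1 ≤ i → + 0 ℤ.≤ φ ⟪ i ⟫ → + 0 ℤ.≤ φ ⟪ suc i ⟫
⟪⟫-nonneg-suc {[]}         _         i             _ _  = ℤ.+≤+ z≤n
⟪⟫-nonneg-suc {_ ∷ []}     _         (suc zero)    _ _  = ℤ.+≤+ z≤n
⟪⟫-nonneg-suc {_ ∷ _ ∷ _}  (x≤y ∷ _) (suc zero)    _ 0≤x = ℤ≤-trans 0≤x x≤y
⟪⟫-nonneg-suc {_ ∷ φ}      l         (suc (suc i)) _ 0≤φᵢ = ⟪⟫-nonneg-suc (tail l) (suc i) (s≤s z≤n) 0≤φᵢ

⟪⟫-nonneg-mono : ∀ {φ i c} → Increasing φ → 1 ≤ i → i ≤ c → + 0 ℤ.≤ φ ⟪ i ⟫ → + 0 ℤ.≤ φ ⟪ c ⟫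
⟪⟫-nonneg-mono {φ} {i} φ↑ 1≤i i≤c 0≤φᵢ = go (≤⇒≤′ i≤c)
  where
  go : ∀ {c} → i ≤′ c → + 0 ℤ.≤ φ ⟪ c ⟫
  go ≤′-refl         = 0≤φᵢ
  go (≤′-step i≤′c) = ⟪⟫-nonneg-suc φ↑ _ (≤-trans 1≤i (≤′⇒≤ i≤′c)) (go i≤′c)

ξat-≡0 : ∀ φ ν j → + 0 ℤ.≤ φ ⟪ conj ν ⟨ j ⟩ ⟫ → ξat φ ν j ≡ + 0
ξat-≡0 φ ν j 0≤φ = begin
  ξat φ ν j                         ≡⟨ at-map (λ c → ℤ.- φ⁻ φ c) ξ₀≡0 (conj ν) j ⟩
  ℤ.- (φ ⟪ conj ν ⟨ j ⟩ ⟫ ℤ.⊓ + 0) ≡⟨ cong ℤ.-_ (i≥j⇒i⊓j≡j 0≤φ) ⟩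
  + 0                               ∎
  where
  open ≡-Reasoning
  ξ₀≡0 : ℤ.- φ⁻ φ 0 ≡ + 0
  ξ₀≡0 = cong (λ z → ℤ.- (z ℤ.⊓ + 0)) (at-zero (+ 0) φ)

lemma4p1 : (lam : List ℕ) (φ : List ℤ) (ν ρ : List ℕ) →
    IsPartition lam → IsFlag lam φ → Compatible lam φ →
    IsPartition ν → IsPartition ρ → ρ ⊆ₚ ν → ν ⊆ₚ lam →
    (∃[ i ] (1 ≤ i × ρ ⟨ i ⟩ < ν ⟨ i ⟩ × (+ 0) Data.Integer.≤ φ ⟪ i ⟫)) →
    ∃[ j ] (1 ≤ j × conj ρ ⟨ j ⟩ < conj ν ⟨ j ⟩ × ξat φ ν j ≡ + 0)
lemma4p1 _ φ ν ρ _ (φ↑ , _) _ (ν↓ , _) (ρ↓ , _) _ _ (i , 1≤i , ρᵢ<νᵢ , 0≤φᵢ)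
  with ν ⟨ i ⟩ in νᵢ≡
... | zero  = ⊥-elim (n≮0 ρᵢ<νᵢ)
... | suc k = suc k , s≤s z≤n , <-≤-trans ρ'<i i≤ν' ,
              ξat-≡0 φ ν (suc k) (⟪⟫-nonneg-mono φ↑ 1≤i i≤ν' 0≤φᵢ)
  where
  i≤ν' : i ≤ conj ν ⟨ suc k ⟩
  i≤ν' = ≤-conj ν↓ i 1≤i (≤-reflexive (sym νᵢ≡))
  ρ'<i : conj ρ ⟨ suc k ⟩ < i
  ρ'<i = conj-< ρ↓ i 1≤i ρᵢ<νᵢ
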